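{- Let $\mathbf{L}$ be an FL-algebra with a storage modality $!$. Then for all $a\in L$, $-_l\,!a=-_r\,!a$ and $!\,-_l a=!\,-_r a$. Consequently $$-_l\,!\,-_r a=-_r\,!\,-_l a=-_l\,!\,-_l a=-_r\,!\,-_r a.$$
   Context: A residuated lattice is $(L,\sqsubseteq,\otimes,1,\Rightarrow_l,\Rightarrow_r)$ with $(L,\sqsubseteq)$ a lattice (meet $\sqcap$), $(L,\otimes,1)$ a monoid with $\otimes$ monotone in each argument, and $a\sqsubseteq b\Rightarrow_l c$ iff $a\otimes b\sqsubseteq c$ iff $b\sqsubseteq a\Rightarrow_r c$. An FL-algebra is a residuated lattice with a distinguished element $0$; it has negations $-_l a=a\Rightarrow_l 0$ and $-_r a=a\Rightarrow_r 0$. A storage modality is a unary operation $!$ with, for all $a,b$: (s1) $!a\sqsubseteq a$; (s2) $!a\sqsubseteq !!a$; (s3) $!1=1$; (s4) $!(a\sqcap b)=!a\otimes !b$; (s5) $!a\otimes b=b\otimes !a$. -}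

module Defs where

open import Level using (Level; suc; _⊔_)
open import Relation.Binary.PropositionalEquality using (_≡_)
open import Relation.Binary.Lattice using (IsLattice)
open import Algebra.Structures using (IsMonoid)
open import Data.Product using (_×_)

-- Residuation convention:  a ⊑ b ⇒l c  iff  a ⊗ b ⊑ c  iff  b ⊑ a ⇒r c.
record FLAlgebra (c ℓ : Level) : Set (suc (c ⊔ ℓ)) where
  infix  4 _⊑_
  infixr 6 _⊗_
  infixr 5 _⇒l_ _⇒r_
  infixr 7 _⊓_ _⊔L_
  field
    Carrier   : Set c
    _⊑_       : Carrier → Carrier → Set ℓ
    _⊔L_      : Carrier → Carrier → Carrier
    _⊓_       : Carrier → Carrier → Carrier
    isLattice : IsLattice _≡_ _⊑_ _⊔L_ _⊓_
    _⊗_       : Carrier → Carrier → Carrier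
    one       : Carrier
    isMonoid  : IsMonoid _≡_ _⊗_ one
    ⊗-monoˡ   : ∀ {a b} c → a ⊑ b → a ⊗ c ⊑ b ⊗ c
    ⊗-monoʳ   : ∀ {a b} c → a ⊑ b → c ⊗ a ⊑ c ⊗ b
    _⇒l_      : Carrier → Carrier → Carrier
    _⇒r_      : Carrier → Carrier → Carrier
    resˡ-to   : ∀ {a b c} → a ⊑ b ⇒l c → a ⊗ b ⊑ c
    resˡ-from : ∀ {a b c} → a ⊗ b ⊑ c → a ⊑ b ⇒l c
    resʳ-to   : ∀ {a b c} → b ⊑ a ⇒r c → a ⊗ b ⊑ c
    resʳ-from : ∀ {a b c} → a ⊗ b ⊑ c → b ⊑ a ⇒r c
    zero      : Carrier

  -ₗ_ : Carrier → Carrier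
  -ₗ a = a ⇒l zero

  -ᵣ_ : Carrier → Carrier
  -ᵣ a = a ⇒r zero

record IsStorageModality {c ℓ} (L : FLAlgebra c ℓ)
         (! : FLAlgebra.Carrier L → FLAlgebra.Carrier L) : Set (c ⊔ ℓ) where
  open FLAlgebra L
  field
    s1 : ∀ a → ! a ⊑ a
    s2 : ∀ a → ! a ⊑ ! (! a)
    s3 : ! one ≡ one
    s4 : ∀ a b → ! (a ⊓ b) ≡ ! a ⊗ ! b
    s5 : ∀ a b → ! a ⊗ b ≡ b ⊗ ! a

module Submission where

--  * Central elements have a single residual: if c ⊗ x ≡ x ⊗ c for every x,
--    then c ⇒l z ≡ c ⇒r z for every z, since both residuals are characterised
--    by the same set of lower bounds.  By (s5) every ! b is central, which
--    gives  -ₗ ! a ≡ -ᵣ ! a.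
--  * ! is monotone (a consequence of (s1), (s3), (s4)), and (s1), (s5) give
--    ! (b ⇒l z) ⊑ b ⇒r z  together with its mirror image.  Applying the
--    monotone operation ! to both inequalities and using (s2) yields
--    ! (b ⇒l z) ≡ ! (b ⇒r z), in particular  ! -ₗ a ≡ ! -ᵣ a.

open import Defs
open import Data.Product using (_×_; _,_)
open import Relation.Binary.PropositionalEquality using (_≡_; refl; cong; sym)
open import Relation.Binary.PropositionalEquality as ≡ using ()
open import Relation.Binary.Bundles using (Poset)
open import Relation.Binary.Lattice using (IsLattice)
open import Algebra.Structures using (IsMonoid)

module FLAlgebraProperties {c ℓ} (L : FLAlgebra c ℓ) where
  open FLAlgebra L
  module Lat = IsLattice isLattice
  module Mon = IsMonoid isMonoid

  poset : Poset c c ℓ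
  poset = record { isPartialOrder = Lat.isPartialOrder }

  open import Relation.Binary.Reasoning.PartialOrder poset public

  -- Two elements with the same lower bounds are equal (Yoneda for posets);
  -- this is how identities between residuals are proved.
  same-lower-bounds : ∀ {x y} → (∀ {w} → w ⊑ x → w ⊑ y) → (∀ {w} → w ⊑ y → w ⊑ x) → x ≡ y
  same-lower-bounds x→y y→x = Lat.antisym (x→y (Lat.reflexive refl)) (y→x (Lat.reflexive refl))

  central-⇒l≡⇒r : ∀ {e} → (∀ x → e ⊗ x ≡ x ⊗ e) → ∀ z → e ⇒l z ≡ e ⇒r z
  central-⇒l≡⇒r {e} central z = same-lower-bounds
    (λ {w} w⊑e⇒lz → resʳ-from (begin e ⊗ w ≈⟨ central w ⟩ w ⊗ e ≤⟨ resˡ-to w⊑e⇒lz ⟩ z ∎))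
    (λ {w} w⊑e⇒rz → resˡ-from (begin w ⊗ e ≈⟨ central w ⟨ e ⊗ w ≤⟨ resʳ-to w⊑e⇒rz ⟩ z ∎))

  ⇒l-mp : ∀ b z → (b ⇒l z) ⊗ b ⊑ z
  ⇒l-mp b z = resˡ-to (Lat.reflexive refl)

  ⇒r-mp : ∀ b z → b ⊗ (b ⇒r z) ⊑ z
  ⇒r-mp b z = resʳ-to (Lat.reflexive refl)

module StorageModalityProperties {c ℓ} (L : FLAlgebra c ℓ)
         (! : FLAlgebra.Carrier L → FLAlgebra.Carrier L) (S : IsStorageModality L !) where
  open FLAlgebra L
  open IsStorageModality S
  open FLAlgebraProperties L

  !-below-one : ∀ b → ! b ⊑ one
  !-below-one b = begin
    ! b            ≈⟨ Mon.identityʳ (! b) ⟨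
    ! b ⊗ one      ≈⟨ cong (! b ⊗_) s3 ⟨
    ! b ⊗ ! one    ≈⟨ s4 b one ⟨
    ! (b ⊓ one)    ≤⟨ s1 (b ⊓ one) ⟩
    b ⊓ one        ≤⟨ Lat.x∧y≤y b one ⟩
    one            ∎

  !-mono : ∀ {x y} → x ⊑ y → ! x ⊑ ! y
  !-mono {x} {y} x⊑y = begin
    ! x            ≡⟨ cong ! x≡x⊓y ⟩
    ! (x ⊓ y)      ≈⟨ s4 x y ⟩
    ! x ⊗ ! y      ≤⟨ ⊗-monoˡ (! y) (!-below-one x) ⟩
    one ⊗ ! y      ≈⟨ Mon.identityˡ (! y) ⟩
    ! y            ∎
    where
    x≡x⊓y : x ≡ x ⊓ y
    x≡x⊓y = Lat.antisym (Lat.∧-greatest (Lat.reflexive refl) x⊑y) (Lat.x∧y≤x x y)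

  !-antisym : ∀ {x y} → ! x ⊑ y → ! y ⊑ x → ! x ≡ ! y
  !-antisym {x} {y} !x⊑y !y⊑x = Lat.antisym
    (Lat.trans (s2 x) (!-mono !x⊑y))
    (Lat.trans (s2 y) (!-mono !y⊑x))

  !⇒l⊑⇒r : ∀ b z → ! (b ⇒l z) ⊑ b ⇒r z
  !⇒l⊑⇒r b z = resʳ-from (begin
    b ⊗ ! (b ⇒l z)   ≈⟨ s5 (b ⇒l z) b ⟨
    ! (b ⇒l z) ⊗ b   ≤⟨ ⊗-monoˡ b (s1 (b ⇒l z)) ⟩
    (b ⇒l z) ⊗ b     ≤⟨ ⇒l-mp b z ⟩
    z                ∎)

  !⇒r⊑⇒l : ∀ b z → ! (b ⇒r z) ⊑ b ⇒l z
  !⇒r⊑⇒l b z = resˡ-from (begin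
    ! (b ⇒r z) ⊗ b   ≈⟨ s5 (b ⇒r z) b ⟩
    b ⊗ ! (b ⇒r z)   ≤⟨ ⊗-monoʳ b (s1 (b ⇒r z)) ⟩
    b ⊗ (b ⇒r z)     ≤⟨ ⇒r-mp b z ⟩
    z                ∎)

  ⇒l!≡⇒r! : ∀ b z → ! b ⇒l z ≡ ! b ⇒r z
  ⇒l!≡⇒r! b = central-⇒l≡⇒r (s5 b)

  !⇒l≡!⇒r : ∀ b z → ! (b ⇒l z) ≡ ! (b ⇒r z)
  !⇒l≡!⇒r b z = !-antisym (!⇒l⊑⇒r b z) (!⇒r⊑⇒l b z)

lemma5 : ∀ {c ℓ} (L : FLAlgebra c ℓ) (! : FLAlgebra.Carrier L → FLAlgebra.Carrier L)
    → IsStorageModality L ! → (a : FLAlgebra.Carrier L)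
    → let open FLAlgebra L in
    ((-ₗ (! a)) ≡ (-ᵣ (! a)))
    × (! (-ₗ a) ≡ ! (-ᵣ a))
    × ((-ₗ (! (-ᵣ a))) ≡ (-ᵣ (! (-ₗ a))))
    × ((-ᵣ (! (-ₗ a))) ≡ (-ₗ (! (-ₗ a))))
    × ((-ₗ (! (-ₗ a))) ≡ (-ᵣ (! (-ᵣ a))))
lemma5 L ! S a = -ₗ!≡-ᵣ! a , !-ₗ≡!-ᵣ , -ₗ!-ᵣ≡-ᵣ!-ₗ , sym (-ₗ!≡-ᵣ! (-ₗ a)) , -ₗ!-ₗ≡-ᵣ!-ᵣ
  where
  open FLAlgebra L
  open StorageModalityProperties L ! S
  open ≡.≡-Reasoning

  -ₗ!≡-ᵣ! : ∀ b → -ₗ (! b) ≡ -ᵣ (! b)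
  -ₗ!≡-ᵣ! b = ⇒l!≡⇒r! b zero

  !-ₗ≡!-ᵣ : ! (-ₗ a) ≡ ! (-ᵣ a)
  !-ₗ≡!-ᵣ = !⇒l≡!⇒r a zero

  -ₗ!-ᵣ≡-ᵣ!-ₗ : -ₗ (! (-ᵣ a)) ≡ -ᵣ (! (-ₗ a))
  -ₗ!-ᵣ≡-ᵣ!-ₗ = begin
    -ₗ (! (-ᵣ a))  ≡⟨ cong -ₗ_ !-ₗ≡!-ᵣ ⟨
    -ₗ (! (-ₗ a))  ≡⟨ -ₗ!≡-ᵣ! (-ₗ a) ⟩
    -ᵣ (! (-ₗ a))  ∎

  -ₗ!-ₗ≡-ᵣ!-ᵣ : -ₗ (! (-ₗ a)) ≡ -ᵣ (! (-ᵣ a))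
  -ₗ!-ₗ≡-ᵣ!-ᵣ = begin
    -ₗ (! (-ₗ a))  ≡⟨ -ₗ!≡-ᵣ! (-ₗ a) ⟩
    -ᵣ (! (-ₗ a))  ≡⟨ cong -ᵣ_ !-ₗ≡!-ᵣ ⟩
    -ᵣ (! (-ᵣ a))  ∎
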